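{- Let $N,j,n\ge0$ be integers. Let $S_{N,j}(n)$ be the number of partitions $\pi$ into distinct parts, all $\le N$, with $\mathcal{O}(\pi)=n$ and $\gamma(\pi)=j$. Let $\Gamma_{N,j}(n)$ be the number of partitions of $n$ into exactly $j$ parts whose largest hook length is $\le N$. Then $S_{N,j}(n)=\Gamma_{N,j}(n)$.
   Context: A partition $\pi=(\lambda_1,\lambda_2,\dots)$ is a finite non-increasing sequence of positive integers; the empty sequence is the unique partition of $0$. $\mathcal{O}(\pi)=\lambda_1+\lambda_3+\cdots$ and $\gamma(\pi)=\lambda_1-\lambda_2+\lambda_3-\lambda_4+\cdots$. The largest hook length of a nonempty partition is (number of parts) + (largest part) $-1$ (the hook length of the top-left box of its Ferrers diagram), and $0$ for the empty partition. -}

module Defs where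

open import Data.Nat using (ℕ; zero; suc; _+_; _∸_; _≤_; _<_; _≥_)
open import Data.List using (List; []; _∷_; length)
open import Data.List.Relation.Unary.All using (All)
open import Data.List.Relation.Unary.Linked using (Linked)
open import Data.List.Membership.Propositional using (_∈_)
open import Data.List.Relation.Unary.Unique.Propositional using (Unique)
open import Data.Integer as ℤ using (ℤ; +_)
open import Data.Product using (_×_)
open import Function.Bundles using (_⇔_)
open import Relation.Binary.PropositionalEquality using (_≡_)

IsPartition : List ℕ → Set
IsPartition π = All (λ x → 1 ≤ x) π × Linked (λ a b → b ≤ a) π

IsDistinctPartition : List ℕ → Set
IsDistinctPartition π = All (λ x → 1 ≤ x) π × Linked (λ a b → b < a) π

size : List ℕ → ℕ
size [] = 0
size (x ∷ xs) = x + size xs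

oddSum : List ℕ → ℕ
oddSum [] = 0
oddSum (x ∷ []) = x
oddSum (x ∷ _ ∷ xs) = x + oddSum xs

altSum : List ℕ → ℤ
altSum [] = + 0
altSum (x ∷ xs) = + x ℤ.- altSum xs

largestPart : List ℕ → ℕ
largestPart [] = 0
largestPart (x ∷ _) = x

largestHook : List ℕ → ℕ
largestHook [] = 0
largestHook π@(_ ∷ _) = length π + largestPart π ∸ 1

SProp : ℕ → ℕ → ℕ → List ℕ → Set
SProp N j n π = IsDistinctPartition π × All (λ x → x ≤ N) π
              × oddSum π ≡ n × altSum π ≡ + j

ΓProp : ℕ → ℕ → ℕ → List ℕ → Set
ΓProp N j n π = IsPartition π × size π ≡ n × length π ≡ j × largestHook π ≤ N

-- L is a duplicate-free exhaustive listing of {π | P π};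
-- its length is then the number of such π.
Enumerates : (List ℕ → Set) → List (List ℕ) → Set
Enumerates P L = Unique L × (∀ π → (π ∈ L) ⇔ P π)

{-# OPTIONS --safe #-}
module Submission where

-- Read a distinct partition π = (h₁ > a₁ > h₂ > a₂ > ⋯) as the hook lengths of the cells
-- (1,1), (1,2), (2,2), (2,3), … of an ordinary partition μ: the first hook of μ has
-- length h₁ and arm a₁ − ℓ, where ℓ is the number of rows of the interior of μ (μ without
-- its first row and column), and the interior is encoded by h₂ > a₂ > ⋯ .
-- The diagonal hooks partition the cells of μ, so |μ| = h₁ + h₂ + ⋯ = 𝒪(π); h₁ − a₁ is
-- the number of rows lost with the first column, so γ(π) is the number of rows of μ;
-- and h₁ is the largest hook of μ.

open import Defs
open import Data.Nat using (ℕ; zero; suc; _+_; _∸_; _≤_; _<_; z≤n; s≤s)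
open import Data.Nat.Properties
open import Data.Nat.Tactic.RingSolver using (solve-∀)
open import Algebra.Properties.CommutativeSemigroup +-commutativeSemigroup using (x∙yz≈y∙xz)
open import Data.Integer as ℤ using (+_)
import Data.Integer.Properties as ℤP
open import Data.List using (List; []; _∷_; length; map; _++_; replicate)
open import Data.List.Properties using (length-map; length-++; length-replicate; map-∘; map-id-local)
open import Data.List.Relation.Unary.All as All using (All; []; _∷_)
open import Data.List.Relation.Unary.Linked using ([]; [-]; _∷_)
open import Data.List.Relation.Unary.Unique.Propositional using (Unique)
open import Data.List.Relation.Unary.Unique.Propositional.Properties using (map⁻)
open import Data.List.Membership.Propositional using (_∈_)
open import Data.List.Membership.Propositional.Properties using (∈-map⁺; ∈-map⁻)
open import Data.List.Membership.Propositional.Properties.WithK using (unique∧set⇒bag)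
open import Data.List.Relation.Binary.BagAndSetEquality using (∼bag⇒↭)
open import Data.List.Relation.Binary.Permutation.Propositional.Properties using (↭-length)
open import Data.Product using (_,_; proj₁)
open import Function.Bundles using (_⇔_; mk⇔; Equivalence)
open import Relation.Binary.PropositionalEquality
open ≡-Reasoning

Enumerates⇒length-≡ : ∀ {P Q : List ℕ → Set} {LP LQ} (f g : List ℕ → List ℕ) →
  (∀ {x} → P x → Q (f x)) → (∀ {y} → Q y → P (g y)) →
  (∀ {x} → P x → g (f x) ≡ x) → (∀ {y} → Q y → f (g y) ≡ y) →
  Enumerates P LP → Enumerates Q LQ → length LP ≡ length LQ
Enumerates⇒length-≡ {LP = LP} {LQ} f g P⇒Qf Q⇒Pg gf≡id fg≡id (uniqueP , ∈P) (uniqueQ , ∈Q) =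
  begin
    length LP         ≡⟨ length-map f LP ⟨
    length (map f LP) ≡⟨ ↭-length (∼bag⇒↭ (unique∧set⇒bag uniqueImage uniqueQ image⇔LQ)) ⟩
    length LQ         ∎
  where
  round-trip : map g (map f LP) ≡ LP
  round-trip = trans (sym (map-∘ LP)) (map-id-local (All.map gf≡id (All.tabulate (Equivalence.to (∈P _)))))

  uniqueImage : Unique (map f LP)
  uniqueImage = map⁻ (subst Unique (sym round-trip) uniqueP)

  image⇔LQ : ∀ {y} → y ∈ map f LP ⇔ y ∈ LQ
  image⇔LQ {y} = mk⇔ to from
    where
    to : y ∈ map f LP → y ∈ LQ
    to y∈ with ∈-map⁻ f y∈
    ... | x , x∈LP , refl = Equivalence.from (∈Q (f x)) (P⇒Qf (Equivalence.to (∈P x) x∈LP))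

    from : y ∈ LQ → y ∈ map f LP
    from y∈LQ = subst (_∈ map f LP) (fg≡id Qy) (∈-map⁺ f (Equivalence.from (∈P (g y)) (Q⇒Pg Qy)))
      where Qy = Equivalence.to (∈Q y) y∈LQ

n+k≡m⇒+m-+n≡+k : ∀ {m n k} → n + k ≡ m → + m ℤ.- + n ≡ + k
n+k≡m⇒+m-+n≡+k {n = n} {k} refl =
  trans (ℤP.[+m]-[+n]≡m⊖n (n + k) n) (trans (ℤP.⊖-≥ (m≤m+n n k)) (cong +_ (m+n∸m≡n n k)))

-- h is the hook length of the cell (1,1): the arm a ∸ ℓ plus a first column of 1 + ℓ + (h ∸ suc a) cells.
hookLength-split : ∀ {ℓ a h} → ℓ ≤ a → a < h → a ∸ ℓ + suc (ℓ + (h ∸ suc a)) ≡ h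
hookLength-split {ℓ} {a} {h} ℓ≤a a<h = begin
  a ∸ ℓ + suc (ℓ + (h ∸ suc a)) ≡⟨ reorder (a ∸ ℓ) ℓ (h ∸ suc a) ⟩
  suc (ℓ + (a ∸ ℓ) + (h ∸ suc a)) ≡⟨ cong (λ x → suc x + (h ∸ suc a)) (m+[n∸m]≡n ℓ≤a) ⟩
  suc a + (h ∸ suc a)             ≡⟨ m+[n∸m]≡n a<h ⟩
  h                               ∎
  where
  reorder : ∀ arm ℓ leg → arm + suc (ℓ + leg) ≡ suc (ℓ + arm + leg)
  reorder = solve-∀

data Distinct< : ℕ → List ℕ → Set where
  []   : ∀ {c} → Distinct< c []
  cons : ∀ {c x xs} → 1 ≤ x → x < c → Distinct< x xs → Distinct< c (x ∷ xs)

data Partition≤ : ℕ → List ℕ → Set where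
  []   : ∀ {b} → Partition≤ b []
  cons : ∀ {b x xs} → 1 ≤ x → x ≤ b → Partition≤ x xs → Partition≤ b (x ∷ xs)

largestPart-≤ : ∀ {N π} → All (_≤ N) π → largestPart π ≤ N
largestPart-≤ []        = z≤n
largestPart-≤ (x≤N ∷ _) = x≤N

isDistinctPartition⇒Distinct< : ∀ {c π} → IsDistinctPartition π → largestPart π < c → Distinct< c π
isDistinctPartition⇒Distinct< ([] , _)               _   = []
isDistinctPartition⇒Distinct< (1≤x ∷ [] , [-])        x<c = cons 1≤x x<c []
isDistinctPartition⇒Distinct< (1≤x ∷ ps , y<x ∷ rs) x<c =
  cons 1≤x x<c (isDistinctPartition⇒Distinct< (ps , rs) y<x)

Distinct<⇒isDistinctPartition : ∀ {c π} → Distinct< c π → IsDistinctPartition π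
Distinct<⇒isDistinctPartition []                    = [] , []
Distinct<⇒isDistinctPartition (cons 1≤x _ [])       = 1≤x ∷ [] , [-]
Distinct<⇒isDistinctPartition (cons 1≤x _ d@(cons _ y<x _)) =
  let ps , rs = Distinct<⇒isDistinctPartition d in 1≤x ∷ ps , y<x ∷ rs

Distinct<⇒All< : ∀ {c π} → Distinct< c π → All (_< c) π
Distinct<⇒All< []             = []
Distinct<⇒All< (cons _ x<c d) = x<c ∷ All.map (λ y<x → <-trans y<x x<c) (Distinct<⇒All< d)

isPartition⇒Partition≤ : ∀ {b μ} → IsPartition μ → largestPart μ ≤ b → Partition≤ b μ
isPartition⇒Partition≤ ([] , _)               _   = []
isPartition⇒Partition≤ (1≤x ∷ [] , [-])        x≤b = cons 1≤x x≤b []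
isPartition⇒Partition≤ (1≤x ∷ ps , y≤x ∷ rs) x≤b =
  cons 1≤x x≤b (isPartition⇒Partition≤ (ps , rs) y≤x)

Partition≤⇒isPartition : ∀ {b μ} → Partition≤ b μ → IsPartition μ
Partition≤⇒isPartition []                    = [] , []
Partition≤⇒isPartition (cons 1≤x _ [])       = 1≤x ∷ [] , [-]
Partition≤⇒isPartition (cons 1≤x _ p@(cons _ y≤x _)) =
  let ps , rs = Partition≤⇒isPartition p in 1≤x ∷ ps , y≤x ∷ rs

Partition≤-weaken : ∀ {b b′ μ} → b ≤ b′ → Partition≤ b μ → Partition≤ b′ μ
Partition≤-weaken _     []               = []
Partition≤-weaken b≤b′ (cons 1≤x x≤b p) = cons 1≤x (≤-trans x≤b b≤b′) p

Partition≤0⇒≡[] : ∀ {μ} → Partition≤ 0 μ → μ ≡ []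
Partition≤0⇒≡[] []              = refl
Partition≤0⇒≡[] (cons () z≤n _)

Partition≤1⇒≡replicate : ∀ {μ} → Partition≤ 1 μ → replicate (length μ) 1 ≡ μ
Partition≤1⇒≡replicate []                             = refl
Partition≤1⇒≡replicate (cons {x = suc zero} _ _ p)    = cong (1 ∷_) (Partition≤1⇒≡replicate p)
Partition≤1⇒≡replicate (cons {x = suc (suc _)} _ (s≤s ()) _)

replicate-Partition≤ : ∀ k {b} → 1 ≤ b → Partition≤ b (replicate k 1)
replicate-Partition≤ zero    _   = []
replicate-Partition≤ (suc k) 1≤b = cons ≤-refl 1≤b (replicate-Partition≤ k ≤-refl)

largestHook-≤ : ∀ {b ν} → Partition≤ (suc b) ν → largestHook ν ≤ b + length ν
largestHook-≤ []                               = z≤n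
largestHook-≤ {b} (cons {x = y} {ν} _ y≤1+b _) =
  ≤-trans (+-monoʳ-≤ (length ν) y≤1+b) (≤-reflexive (trans (+-comm (length ν) (suc b)) (sym (+-suc b (length ν)))))

length+largestPart≤1+n⇒largestHook≤n : ∀ {n} μ → length μ + largestPart μ ≤ suc n → largestHook μ ≤ n
length+largestPart≤1+n⇒largestHook≤n []      _       = z≤n
length+largestPart≤1+n⇒largestHook≤n (_ ∷ _) (s≤s le) = le

size-replicate : ∀ k → size (replicate k 1) ≡ k
size-replicate zero    = refl
size-replicate (suc k) = cong suc (size-replicate k)

addFirstColumn : List ℕ → ℕ → List ℕ
addFirstColumn ν k = map suc ν ++ replicate k 1

dropFirstColumn : List ℕ → List ℕ
dropFirstColumn []                = []
dropFirstColumn (suc (suc x) ∷ μ) = suc x ∷ dropFirstColumn μ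
dropFirstColumn (_ ∷ μ)           = dropFirstColumn μ

length-addFirstColumn : ∀ ν k → length (addFirstColumn ν k) ≡ length ν + k
length-addFirstColumn ν k =
  trans (length-++ (map suc ν)) (cong₂ _+_ (length-map suc ν) (length-replicate k))

size-addFirstColumn : ∀ ν k → size (addFirstColumn ν k) ≡ length ν + size ν + k
size-addFirstColumn []      k = size-replicate k
size-addFirstColumn (x ∷ ν) k =
  cong suc (trans (cong (_+_ x) (size-addFirstColumn ν k)) (reorder x (length ν) (size ν) k))
  where
  reorder : ∀ x l s k → x + (l + s + k) ≡ l + (x + s) + k
  reorder = solve-∀

addFirstColumn-Partition≤ : ∀ {b} ν k → Partition≤ b ν → Partition≤ (suc b) (addFirstColumn ν k)
addFirstColumn-Partition≤ []      k []              = replicate-Partition≤ k (s≤s z≤n)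
addFirstColumn-Partition≤ (_ ∷ ν) k (cons _ x≤b p) =
  cons (s≤s z≤n) (s≤s x≤b) (addFirstColumn-Partition≤ ν k p)

dropFirstColumn-addFirstColumn : ∀ {ν} k → All (1 ≤_) ν → dropFirstColumn (addFirstColumn ν k) ≡ ν
dropFirstColumn-addFirstColumn zero    []         = refl
dropFirstColumn-addFirstColumn (suc k) []         = dropFirstColumn-addFirstColumn k []
dropFirstColumn-addFirstColumn {suc x ∷ _} k (_ ∷ ps) = cong (suc x ∷_) (dropFirstColumn-addFirstColumn k ps)

dropFirstColumn-Partition≤ : ∀ {b μ} → Partition≤ (suc b) μ → Partition≤ b (dropFirstColumn μ)
dropFirstColumn-Partition≤ []                                  = []
dropFirstColumn-Partition≤ (cons {x = suc zero} _ _ p)         = Partition≤-weaken z≤n (dropFirstColumn-Partition≤ p)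
dropFirstColumn-Partition≤ (cons {x = suc (suc _)} _ (s≤s x≤b) p) = cons (s≤s z≤n) x≤b (dropFirstColumn-Partition≤ p)

length-dropFirstColumn-≤ : ∀ μ → length (dropFirstColumn μ) ≤ length μ
length-dropFirstColumn-≤ []                = z≤n
length-dropFirstColumn-≤ (zero ∷ μ)        = m≤n⇒m≤1+n (length-dropFirstColumn-≤ μ)
length-dropFirstColumn-≤ (suc zero ∷ μ)    = m≤n⇒m≤1+n (length-dropFirstColumn-≤ μ)
length-dropFirstColumn-≤ (suc (suc _) ∷ μ) = s≤s (length-dropFirstColumn-≤ μ)

size-dropFirstColumn : ∀ {μ} → All (1 ≤_) μ → size μ ≡ length μ + size (dropFirstColumn μ)
size-dropFirstColumn []                          = refl
size-dropFirstColumn {suc zero ∷ _} (_ ∷ ps)    = cong suc (size-dropFirstColumn ps)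
size-dropFirstColumn {suc (suc x) ∷ μ} (_ ∷ ps) =
  cong suc (trans (cong (_+_ (suc x)) (size-dropFirstColumn ps))
                  (x∙yz≈y∙xz (suc x) (length μ) (size (dropFirstColumn μ))))

addFirstColumn-dropFirstColumn : ∀ {b μ} → Partition≤ b μ →
  addFirstColumn (dropFirstColumn μ) (length μ ∸ length (dropFirstColumn μ)) ≡ μ
addFirstColumn-dropFirstColumn []                                = refl
addFirstColumn-dropFirstColumn (cons {x = suc zero} _ _ p)
  rewrite Partition≤0⇒≡[] (dropFirstColumn-Partition≤ p)       = cong (1 ∷_) (Partition≤1⇒≡replicate p)
addFirstColumn-dropFirstColumn (cons {x = suc (suc x)} _ _ p)    = cong (suc (suc x) ∷_) (addFirstColumn-dropFirstColumn p)

fromHooks : List ℕ → List ℕ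
fromHooks []          = []
fromHooks (h ∷ [])    = replicate h 1
fromHooks (h ∷ a ∷ σ) = let ν = fromHooks σ in suc (a ∸ length ν) ∷ addFirstColumn ν (h ∸ suc a)

-- The recursion is on the interior, which is shorter but not a sublist: hence the fuel.
toHooks′ : ℕ → List ℕ → List ℕ
toHooks′ zero    _                     = []
toHooks′ (suc f) []                    = []
toHooks′ (suc f) (zero ∷ μ)            = []
toHooks′ (suc f) (suc zero ∷ μ)        = suc (length μ) ∷ []
toHooks′ (suc f) (suc (suc q) ∷ μ)     =
  let ν = dropFirstColumn μ in suc (suc q) + length μ ∷ suc q + length ν ∷ toHooks′ f ν

toHooks : List ℕ → List ℕ
toHooks μ = toHooks′ (length μ) μ

fromHooks-hook : ∀ {c σ} → Distinct< c σ → length (fromHooks σ) + largestPart (fromHooks σ) ≤ c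
fromHooks-hook []                            = z≤n
fromHooks-hook (cons {x = suc h} _ h<c [])   =
  ≤-trans (≤-reflexive (trans (cong (_+ 1) (length-replicate (suc h))) (+-comm (suc h) 1))) h<c
fromHooks-hook (cons {x = h} _ h<c (cons {x = a} {σ} _ a<h d)) = ≤-trans (≤-reflexive hook≡) h<c
  where
  ν = fromHooks σ
  ℓ≤a : length ν ≤ a
  ℓ≤a = m+n≤o⇒m≤o (length ν) (fromHooks-hook d)
  hook≡ : suc (length (addFirstColumn ν (h ∸ suc a))) + suc (a ∸ length ν) ≡ suc h
  hook≡ = begin
    suc (length (addFirstColumn ν (h ∸ suc a))) + suc (a ∸ length ν)
      ≡⟨ cong (λ l → suc l + suc (a ∸ length ν)) (length-addFirstColumn ν (h ∸ suc a)) ⟩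
    suc (length ν + (h ∸ suc a)) + suc (a ∸ length ν)
      ≡⟨ +-suc _ (a ∸ length ν) ⟩
    suc (suc (length ν + (h ∸ suc a)) + (a ∸ length ν))
      ≡⟨ cong suc (+-comm _ (a ∸ length ν)) ⟩
    suc (a ∸ length ν + suc (length ν + (h ∸ suc a)))
      ≡⟨ cong suc (hookLength-split ℓ≤a a<h) ⟩
    suc h ∎

length-fromHooks-≤ : ∀ {c σ} → Distinct< c σ → length (fromHooks σ) ≤ c
length-fromHooks-≤ d = m+n≤o⇒m≤o _ (fromHooks-hook d)

fromHooks-Partition≤ : ∀ {c σ} → Distinct< c σ → Partition≤ (largestPart (fromHooks σ)) (fromHooks σ)
fromHooks-Partition≤ []                          = []
fromHooks-Partition≤ (cons {x = suc h} _ _ [])   = replicate-Partition≤ (suc h) ≤-refl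
fromHooks-Partition≤ (cons {x = h} _ _ (cons {x = a} {σ} _ _ d)) =
  cons (s≤s z≤n) ≤-refl (addFirstColumn-Partition≤ ν (h ∸ suc a) (Partition≤-weaken largest≤arm (fromHooks-Partition≤ d)))
  where
  ν = fromHooks σ
  largest≤arm : largestPart ν ≤ a ∸ length ν
  largest≤arm = m+n≤o⇒m≤o∸n (largestPart ν) (subst (_≤ a) (+-comm (length ν) _) (fromHooks-hook d))

size-fromHooks : ∀ {c σ} → Distinct< c σ → size (fromHooks σ) ≡ oddSum σ
size-fromHooks []                          = refl
size-fromHooks (cons {x = h} _ _ [])       = size-replicate h
size-fromHooks (cons {x = h} _ _ (cons {x = a} {σ} _ a<h d)) = begin
  suc arm + size (addFirstColumn ν leg) ≡⟨ cong (_+_ (suc arm)) (size-addFirstColumn ν leg) ⟩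
  suc arm + (ℓ + size ν + leg)          ≡⟨ reorder arm ℓ (size ν) leg ⟩
  arm + suc (ℓ + leg) + size ν          ≡⟨ cong₂ _+_ (hookLength-split (length-fromHooks-≤ d) a<h) (size-fromHooks d) ⟩
  h + oddSum σ                          ∎
  where
  ν = fromHooks σ
  ℓ = length ν
  arm = a ∸ ℓ
  leg = h ∸ suc a
  reorder : ∀ arm ℓ s leg → suc arm + (ℓ + s + leg) ≡ arm + suc (ℓ + leg) + s
  reorder = solve-∀

altSum-fromHooks : ∀ {c σ} → Distinct< c σ → altSum σ ≡ + length (fromHooks σ)
altSum-fromHooks []                    = refl
altSum-fromHooks (cons {x = h} _ _ []) = cong +_ (trans (+-identityʳ h) (sym (length-replicate h)))
altSum-fromHooks (cons {x = h} _ _ (cons {x = a} {σ} _ a<h d)) = begin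
  + h ℤ.- (+ a ℤ.- altSum σ)   ≡⟨ cong (λ z → + h ℤ.- (+ a ℤ.- z)) (altSum-fromHooks d) ⟩
  + h ℤ.- (+ a ℤ.- + ℓ)        ≡⟨ cong (λ z → + h ℤ.- z) (n+k≡m⇒+m-+n≡+k {n = ℓ} (m+[n∸m]≡n ℓ≤a)) ⟩
  + h ℤ.- + (a ∸ ℓ)            ≡⟨ n+k≡m⇒+m-+n≡+k {n = a ∸ ℓ} (hookLength-split ℓ≤a a<h) ⟩
  + suc (ℓ + leg)              ≡⟨ cong (λ l → + suc l) (length-addFirstColumn ν leg) ⟨
  + suc (length (addFirstColumn ν leg)) ∎
  where
  ν = fromHooks σ
  ℓ = length ν
  leg = h ∸ suc a
  ℓ≤a : ℓ ≤ a
  ℓ≤a = length-fromHooks-≤ d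

toHooks′-addFirstColumn : ∀ f {arm} ν leg → 1 ≤ arm → All (1 ≤_) ν →
  toHooks′ (suc f) (suc arm ∷ addFirstColumn ν leg) ≡ suc arm + (length ν + leg) ∷ arm + length ν ∷ toHooks′ f ν
toHooks′-addFirstColumn f ν leg (s≤s z≤n) pos
  rewrite dropFirstColumn-addFirstColumn leg pos | length-addFirstColumn ν leg = refl

toHooks′-fromHooks : ∀ {c σ} → Distinct< c σ → ∀ f → length (fromHooks σ) ≤ f → toHooks′ f (fromHooks σ) ≡ σ
toHooks′-fromHooks []                          zero    _ = refl
toHooks′-fromHooks []                          (suc f) _ = refl
toHooks′-fromHooks (cons {x = suc h} _ _ [])   (suc f) _ = cong (λ l → suc l ∷ []) (length-replicate h)
toHooks′-fromHooks (cons {x = h} _ _ (cons {x = a} {σ} 1≤a a<h d)) (suc f) (s≤s fuel) = begin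
  toHooks′ (suc f) (suc arm ∷ addFirstColumn ν leg)  ≡⟨ toHooks′-addFirstColumn f ν leg 1≤arm positive ⟩
  suc arm + (ℓ + leg) ∷ arm + ℓ ∷ toHooks′ f ν      ≡⟨ cong₂ _∷_ first-hook (cong₂ _∷_ (m∸n+n≡m ℓ≤a) rest) ⟩
  h ∷ a ∷ σ                                          ∎
  where
  ν = fromHooks σ
  ℓ = length ν
  arm = a ∸ ℓ
  leg = h ∸ suc a
  ℓ≤a : ℓ ≤ a
  ℓ≤a = length-fromHooks-≤ d
  positive : All (1 ≤_) ν
  positive = proj₁ (Partition≤⇒isPartition (fromHooks-Partition≤ d))
  ℓ<a : ℓ < a
  ℓ<a with fromHooks σ | fromHooks-Partition≤ d | fromHooks-hook d
  ... | []    | _              | _    = 1≤a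
  ... | _ ∷ _ | cons 1≤x _ _ | hook = ≤-trans (≤-reflexive (+-comm 1 _)) (≤-trans (+-monoʳ-≤ _ 1≤x) hook)
  1≤arm : 1 ≤ arm
  1≤arm = m<n⇒0<n∸m ℓ<a
  first-hook : suc arm + (ℓ + leg) ≡ h
  first-hook = trans (sym (+-suc arm (ℓ + leg))) (hookLength-split ℓ≤a a<h)
  rest : toHooks′ f ν ≡ σ
  rest = toHooks′-fromHooks d f (≤-trans (m≤m+n ℓ leg) (subst (_≤ f) (length-addFirstColumn ν leg) fuel))

fromHooks-toHooks′ : ∀ f {b μ} → length μ ≤ f → Partition≤ b μ → fromHooks (toHooks′ f μ) ≡ μ
fromHooks-toHooks′ zero    {μ = []} _ _ = refl
fromHooks-toHooks′ (suc f) {μ = []} _ _ = refl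
fromHooks-toHooks′ (suc f) (s≤s _) (cons {x = suc zero} _ _ p) = cong (1 ∷_) (Partition≤1⇒≡replicate p)
fromHooks-toHooks′ (suc f) (s≤s fuel) (cons {x = suc (suc q)} {μ} _ _ p)
  rewrite fromHooks-toHooks′ f (≤-trans (length-dropFirstColumn-≤ μ) fuel) (dropFirstColumn-Partition≤ p)
        | m+n∸n≡m (suc q) (length (dropFirstColumn μ))
        | [m+n]∸[m+o]≡n∸o q (length μ) (length (dropFirstColumn μ))
  = cong (suc (suc q) ∷_) (addFirstColumn-dropFirstColumn p)

toHooks′-Distinct< : ∀ f {b c μ} → length μ ≤ f → Partition≤ b μ → largestHook μ < c → Distinct< c (toHooks′ f μ)
toHooks′-Distinct< zero    {μ = []} _ _ _ = []
toHooks′-Distinct< (suc f) {μ = []} _ _ _ = []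
toHooks′-Distinct< (suc f) _ (cons {x = zero} () _ _) _
toHooks′-Distinct< (suc f) {c = c} {suc zero ∷ μ} _ _ hook<c =
  cons (s≤s z≤n) (subst (_< c) (+-comm (length μ) 1) hook<c) []
toHooks′-Distinct< (suc f) {c = c} {suc (suc q) ∷ μ} (s≤s fuel) (cons _ _ p) hook<c =
  cons (s≤s z≤n) (subst (_< c) (+-comm (length μ) (suc (suc q))) hook<c)
    (cons (s≤s z≤n) (s≤s (s≤s (+-monoʳ-≤ q t≤L)))
      (toHooks′-Distinct< f (≤-trans t≤L fuel) interior (s≤s (largestHook-≤ interior))))
  where
  t≤L : length (dropFirstColumn μ) ≤ length μ
  t≤L = length-dropFirstColumn-≤ μ
  interior : Partition≤ (suc q) (dropFirstColumn μ)
  interior = dropFirstColumn-Partition≤ p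

oddSum-toHooks′ : ∀ f {b μ} → length μ ≤ f → Partition≤ b μ → oddSum (toHooks′ f μ) ≡ size μ
oddSum-toHooks′ zero    {μ = []} _ _ = refl
oddSum-toHooks′ (suc f) {μ = []} _ _ = refl
oddSum-toHooks′ (suc f) (s≤s _) (cons {x = suc zero} {μ} _ _ p) =
  cong suc (sym (trans (cong size (sym (Partition≤1⇒≡replicate p))) (size-replicate (length μ))))
oddSum-toHooks′ (suc f) (s≤s fuel) (cons {x = suc (suc q)} {μ} _ _ p) = begin
  suc (suc q) + length μ + oddSum (toHooks′ f ν) ≡⟨ cong (_+_ (suc (suc q) + length μ)) interior-oddSum ⟩
  suc (suc q) + length μ + size ν                ≡⟨ +-assoc (suc (suc q)) (length μ) (size ν) ⟩
  suc (suc q) + (length μ + size ν)              ≡⟨ cong (_+_ (suc (suc q))) (size-dropFirstColumn positive) ⟨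
  suc (suc q) + size μ                           ∎
  where
  ν = dropFirstColumn μ
  positive : All (1 ≤_) μ
  positive = proj₁ (Partition≤⇒isPartition p)
  interior-oddSum : oddSum (toHooks′ f ν) ≡ size ν
  interior-oddSum = oddSum-toHooks′ f (≤-trans (length-dropFirstColumn-≤ μ) fuel) (dropFirstColumn-Partition≤ p)

altSum-toHooks′ : ∀ f {b μ} → length μ ≤ f → Partition≤ b μ → altSum (toHooks′ f μ) ≡ + length μ
altSum-toHooks′ zero    {μ = []} _ _ = refl
altSum-toHooks′ (suc f) {μ = []} _ _ = refl
altSum-toHooks′ (suc f) (s≤s _) (cons {x = suc zero} {μ} _ _ _) = cong +_ (+-identityʳ (suc (length μ)))
altSum-toHooks′ (suc f) (s≤s fuel) (cons {x = suc (suc q)} {μ} _ _ p) = begin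
  + h ℤ.- (+ (suc q + t) ℤ.- altSum (toHooks′ f ν)) ≡⟨ cong (λ z → + h ℤ.- (+ (suc q + t) ℤ.- z)) interior-altSum ⟩
  + h ℤ.- (+ (suc q + t) ℤ.- + t)                   ≡⟨ cong (λ z → + h ℤ.- z) (n+k≡m⇒+m-+n≡+k {n = t} (+-comm t (suc q))) ⟩
  + h ℤ.- + suc q                                   ≡⟨ n+k≡m⇒+m-+n≡+k {n = suc q} (+-suc (suc q) (length μ)) ⟩
  + suc (length μ)                                  ∎
  where
  ν = dropFirstColumn μ
  t = length ν
  h = suc (suc q) + length μ
  interior-altSum : altSum (toHooks′ f ν) ≡ + t
  interior-altSum = altSum-toHooks′ f (≤-trans (length-dropFirstColumn-≤ μ) fuel) (dropFirstColumn-Partition≤ p)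

toHooks-fromHooks : ∀ {c σ} → Distinct< c σ → toHooks (fromHooks σ) ≡ σ
toHooks-fromHooks d = toHooks′-fromHooks d _ ≤-refl

fromHooks-toHooks : ∀ {b μ} → Partition≤ b μ → fromHooks (toHooks μ) ≡ μ
fromHooks-toHooks = fromHooks-toHooks′ _ ≤-refl

SProp⇒Distinct< : ∀ {N j n π} → SProp N j n π → Distinct< (suc N) π
SProp⇒Distinct< (distinct , ≤N , _) = isDistinctPartition⇒Distinct< distinct (s≤s (largestPart-≤ ≤N))

ΓProp⇒Partition≤ : ∀ {N j n μ} → ΓProp N j n μ → Partition≤ (largestPart μ) μ
ΓProp⇒Partition≤ (partition , _) = isPartition⇒Partition≤ partition ≤-refl

fromHooks-SProp⇒ΓProp : ∀ {N j n π} → SProp N j n π → ΓProp N j n (fromHooks π)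
fromHooks-SProp⇒ΓProp {π = π} s@(_ , _ , oddSum≡n , altSum≡j) =
    Partition≤⇒isPartition (fromHooks-Partition≤ d)
  , trans (size-fromHooks d) oddSum≡n
  , ℤP.+-injective (trans (sym (altSum-fromHooks d)) altSum≡j)
  , length+largestPart≤1+n⇒largestHook≤n (fromHooks π) (fromHooks-hook d)
  where
  d : Distinct< (suc _) π
  d = SProp⇒Distinct< s

toHooks-ΓProp⇒SProp : ∀ {N j n μ} → ΓProp N j n μ → SProp N j n (toHooks μ)
toHooks-ΓProp⇒SProp {μ = μ} γ@(_ , size≡n , length≡j , hook≤N) =
    Distinct<⇒isDistinctPartition d
  , All.map ≤-pred (Distinct<⇒All< d)
  , trans (oddSum-toHooks′ (length μ) ≤-refl p) size≡n
  , trans (altSum-toHooks′ (length μ) ≤-refl p) (cong +_ length≡j)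
  where
  p : Partition≤ (largestPart μ) μ
  p = ΓProp⇒Partition≤ γ
  d : Distinct< (suc _) (toHooks μ)
  d = toHooks′-Distinct< (length μ) ≤-refl p (s≤s hook≤N)

theorem3p5 : (N j n : ℕ) (LS LΓ : List (List ℕ)) →
    Enumerates (SProp N j n) LS → Enumerates (ΓProp N j n) LΓ →
    length LS ≡ length LΓ
theorem3p5 _ _ _ _ _ =
  Enumerates⇒length-≡ fromHooks toHooks fromHooks-SProp⇒ΓProp toHooks-ΓProp⇒SProp
    (λ s → toHooks-fromHooks (SProp⇒Distinct< s)) (λ γ → fromHooks-toHooks (ΓProp⇒Partition≤ γ))
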